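{- Let $C=v_1,e_1,\ldots,v_s,e_s,v_1$ be a cycle in a graph, with $e_i=v_iv_{i+1}$ (indices mod $s$). Let $q\geq 2$ be an integer and let $A$ and $B$ be nonempty independent subsets of $V(C)$ (independent in $C$) such that for any $v_i\in A$ and $v_j\in B\setminus A$, the cyclic distance $\min\{|i-j|,\, s-|i-j|\}$ is at least $q$. If $B\setminus A\neq \emptyset$, then $|A|\leq s/2-q+1$. -}

module Defs where

open import Data.Nat using (ℕ; suc; _∸_; _⊓_; ∣_-_∣)
open import Data.Fin using (Fin; toℕ)
open import Data.Fin.Subset using (Subset; _∈_)
open import Data.Sum using (_⊎_)
open import Data.Product using (_×_)
open import Data.Empty using (⊥)
open import Relation.Binary.PropositionalEquality using (_≡_)

-- The cycle C = v_0, e_0, v_1, ..., v_{s-1}, e_{s-1}, v_0 on vertex set Fin s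
-- (vertex v_i represented by i; the paper's 1-based indices shifted by one).
NextOf : {s : ℕ} → Fin s → Fin s → Set
NextOf {s} i j = (toℕ j ≡ suc (toℕ i)) ⊎ ((suc (toℕ i) ≡ s) × (toℕ j ≡ 0))

AdjC : {s : ℕ} → Fin s → Fin s → Set
AdjC i j = NextOf i j ⊎ NextOf j i

IndependentC : {s : ℕ} → Subset s → Set
IndependentC X = ∀ i j → i ∈ X → j ∈ X → AdjC i j → ⊥

cdist : {s : ℕ} → Fin s → Fin s → ℕ
cdist {s} i j = ∣ toℕ i - toℕ j ∣ ⊓ (s ∸ ∣ toℕ i - toℕ j ∣)

-- Walk once around the cycle from a vertex b ∈ B ─ A, recording membership in A as a 0/1 word of
-- length s.  Every vertex of A is at cyclic distance at least q from b, so the word vanishes on its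
-- first q and last q − 1 letters; the middle s − 2q + 1 letters contain no two consecutive ones
-- because A is independent, hence at most (s − 2q + 2)/2 of them are ones.
module Submission where

open import Defs
open import Data.Nat using (ℕ; _≤_; _+_; _*_)
open import Data.Fin.Subset using (Subset; _∈_; _─_; ∣_∣; Nonempty)

open import Data.Nat using (zero; suc; _<_; _∸_; _⊓_; ∣_-_∣; NonZero; z≤n; s≤s; z<s)
open import Data.Nat.Properties
open import Data.Nat.DivMod using (_%_; %-pred-≡0; m<[1+n%d]⇒m≤[n%d]; [1+m%d]≤1+n⇒[m%d]≤n; [m+n]%n≡m%n; m<n⇒m%n≡m)
open import Data.Nat.Tactic.RingSolver using (solve-∀)
open import Data.Bool using (Bool; true; false)
open import Data.Fin using (Fin; toℕ) renaming (zero to fzero; suc to fsuc)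
open import Data.Fin.Properties using (toℕ<n; nonZeroIndex)
open import Data.Vec using (Vec; []; _∷_; here; there)
open import Data.Product using (Σ; _×_; _,_)
open import Data.Sum using (_⊎_; inj₁; inj₂)
open import Data.Empty using (⊥; ⊥-elim)
open import Function using (_∘_)
open import Relation.Binary.PropositionalEquality

χ : Bool → ℕ
χ true  = 1
χ false = 0

count : (ℕ → Bool) → ℕ → ℕ
count g zero    = 0
count g (suc n) = χ (g 0) + count (g ∘ suc) n

count-cong : ∀ {g h} n → (∀ i → i < n → g i ≡ h i) → count g n ≡ count h n
count-cong zero    eq = refl
count-cong (suc n) eq = cong₂ _+_ (cong χ (eq 0 z<s)) (count-cong n (λ i i<n → eq (suc i) (s≤s i<n)))

count-false : ∀ {g} n → (∀ i → i < n → g i ≡ false) → count g n ≡ 0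
count-false zero    _   = refl
count-false (suc n) g≡f rewrite g≡f 0 z<s = count-false n (λ i i<n → g≡f (suc i) (s≤s i<n))

count-+ : ∀ g m n → count g (m + n) ≡ count g m + count (λ i → g (m + i)) n
count-+ g zero    n = refl
count-+ g (suc m) n = trans (cong (χ (g 0) +_) (count-+ (g ∘ suc) m n)) (sym (+-assoc (χ (g 0)) _ _))

count-suc-last : ∀ g n → count g (suc n) ≡ count g n + χ (g n)
count-suc-last g n = begin
    count g (suc n)                          ≡⟨ cong (count g) (+-comm 1 n) ⟩
    count g (n + 1)                          ≡⟨ count-+ g n 1 ⟩
    count g n + (χ (g (n + 0)) + 0)          ≡⟨ cong (count g n +_) (+-identityʳ _) ⟩
    count g n + χ (g (n + 0))                ≡⟨ cong (λ i → count g n + χ (g i)) (+-identityʳ n) ⟩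
    count g n + χ (g n)                      ∎
  where open ≡-Reasoning

-- Rotating one step moves g c from the front of the window to its end, where periodicity puts g (c + n) = g c.
count-rotate : ∀ g n c → (∀ i → g (i + n) ≡ g i) → count (λ i → g (c + i)) n ≡ count g n
count-rotate g n zero    periodic = refl
count-rotate g n (suc c) periodic = begin
    count (λ i → g (suc c + i)) n  ≡⟨ count-cong n (λ i _ → cong g (sym (+-suc c i))) ⟩
    count (h ∘ suc) n              ≡⟨ +-cancelˡ-≡ (χ (h 0)) _ _ shifted ⟩
    count h n                      ≡⟨ count-rotate g n c periodic ⟩
    count g n                      ∎
  where
  open ≡-Reasoning
  h : ℕ → Bool
  h i = g (c + i)
  shifted : χ (h 0) + count (h ∘ suc) n ≡ χ (h 0) + count h n
  shifted = begin
    count h (suc n)        ≡⟨ count-suc-last h n ⟩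
    count h n + χ (h n)    ≡⟨ cong (λ b → count h n + χ b) (trans (periodic c) (cong g (sym (+-identityʳ c)))) ⟩
    count h n + χ (h 0)    ≡⟨ +-comm (count h n) _ ⟩
    χ (h 0) + count h n    ∎

NoConsecutive : (ℕ → Bool) → Set
NoConsecutive g = ∀ k → g k ≡ true → g (suc k) ≡ false

noConsecutive-shift : ∀ {g} c → NoConsecutive g → NoConsecutive (λ i → g (c + i))
noConsecutive-shift {g} c nc k gk = subst (λ j → g j ≡ false) (sym (+-suc c k)) (nc (c + k) gk)

χ≤1 : ∀ b → χ b ≤ 1
χ≤1 true  = s≤s z≤n
χ≤1 false = z≤n

-- A one in front forces a zero after it, so the window shrinks by two; a zero in front shrinks it by one.
count-noConsecutive-step : ∀ n {g} → NoConsecutive g →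
  2 * count (g ∘ suc) (suc n) ≤ suc n + 1 → 2 * count (g ∘ suc ∘ suc) n ≤ n + 1 →
  2 * count g (suc (suc n)) ≤ suc (suc n) + 1
count-noConsecutive-step n {g} nc ih₁ ih₂ with g 0 | nc 0
... | false | _        = ≤-trans ih₁ (n≤1+n _)
... | true  | g1≡false rewrite g1≡false refl = subst (_≤ suc (suc n) + 1) (sym (*-suc 2 _)) (s≤s (s≤s ih₂))

count-noConsecutive : ∀ n {g} → NoConsecutive g → 2 * count g n ≤ n + 1
count-noConsecutive zero          nc = z≤n
count-noConsecutive (suc zero)    {g} nc = subst (_≤ 2) (sym (cong (2 *_) (+-identityʳ (χ (g 0))))) (*-monoʳ-≤ 2 (χ≤1 (g 0)))
count-noConsecutive (suc (suc n)) nc =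
  count-noConsecutive-step n nc (count-noConsecutive (suc n) (nc ∘ suc)) (count-noConsecutive n (nc ∘ suc ∘ suc))

count-trim : ∀ g p m r → (∀ i → i < p → g i ≡ false) → (∀ i → i < r → g (p + (m + i)) ≡ false) →
  count g (p + (m + r)) ≡ count (λ i → g (p + i)) m
count-trim g p m r prefix-false suffix-false = begin
    count g (p + (m + r))                                        ≡⟨ count-+ g p (m + r) ⟩
    count g p + count (λ i → g (p + i)) (m + r)                  ≡⟨ cong (_+ count (λ i → g (p + i)) (m + r)) (count-false p prefix-false) ⟩
    count (λ i → g (p + i)) (m + r)                              ≡⟨ count-+ (λ i → g (p + i)) m r ⟩
    count (λ i → g (p + i)) m + count (λ i → g (p + (m + i))) r  ≡⟨ cong (_ +_) (count-false r suffix-false) ⟩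
    count (λ i → g (p + i)) m + 0                                ≡⟨ +-identityʳ _ ⟩
    count (λ i → g (p + i)) m                                    ∎
  where open ≡-Reasoning

-- d ⊓ (s ∸ d) is the cyclic distance from 0 to d modulo s.
Gapped : ℕ → ℕ → (ℕ → Bool) → Set
Gapped s q g = ∀ d → d < s → g d ≡ true → q ≤ d ⊓ (s ∸ d)

gapped-false : ∀ {s q g} → Gapped s q g → ∀ d → d < s → d < q ⊎ s < q + d → g d ≡ false
gapped-false {s} {q} {g} gapped d d<s out with g d in gd
... | false = refl
... | true  = ⊥-elim (excluded out)
  where
  q≤ : q ≤ d ⊓ (s ∸ d)
  q≤ = gapped d d<s gd
  excluded : d < q ⊎ s < q + d → ⊥
  excluded (inj₁ d<q)   = <⇒≱ d<q (m≤n⊓o⇒m≤n d _ q≤)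
  excluded (inj₂ s<q+d) = <⇒≱ s<q+d (m≤o∸n⇒m+n≤o q (<⇒≤ d<s) (m≤n⊓o⇒m≤o d _ q≤))

count-gapped : ∀ g s q → NoConsecutive g → q + q ≤ s → Gapped s q g → 2 * count g s + 2 * q ≤ s + 2
count-gapped g s zero    nc _ _ =
  subst (_≤ s + 2) (sym (+-identityʳ _)) (≤-trans (count-noConsecutive s nc) (+-monoʳ-≤ s (s≤s z≤n)))
count-gapped g s (suc q′) nc 2q≤s gapped = begin
    2 * count g s + 2 * q                  ≡⟨ cong (λ c → 2 * c + 2 * q) count≡middle ⟩
    2 * count (λ i → g (q + i)) m + 2 * q  ≤⟨ +-monoˡ-≤ (2 * q) (count-noConsecutive m (noConsecutive-shift q nc)) ⟩
    m + 1 + 2 * q                          ≡⟨ lengths₂ q′ o ⟩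
    q + q + o + 2                          ≡⟨ cong (_+ 2) (m+[n∸m]≡n 2q≤s) ⟩
    s + 2                                  ∎
  where
  open ≤-Reasoning
  q = suc q′
  o = s ∸ (q + q)
  m = suc o
  lengths₁ : ∀ q′ o → suc q′ + (suc o + q′) ≡ suc q′ + suc q′ + o
  lengths₁ = solve-∀
  lengths₂ : ∀ q′ o → suc o + 1 + 2 * suc q′ ≡ suc q′ + suc q′ + o + 2
  lengths₂ = solve-∀
  lengths₃ : ∀ q′ o i → suc q′ + (suc q′ + (suc o + i)) ≡ suc (i + (suc q′ + suc q′ + o))
  lengths₃ = solve-∀
  s≡ : q + (m + q′) ≡ s
  s≡ = trans (lengths₁ q′ o) (m+[n∸m]≡n 2q≤s)
  prefix-false : ∀ i → i < q → g i ≡ false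
  prefix-false i i<q = gapped-false gapped i (<-≤-trans i<q (≤-trans (m≤m+n q q) 2q≤s)) (inj₁ i<q)
  suffix-false : ∀ i → i < q′ → g (q + (m + i)) ≡ false
  suffix-false i i<q′ = gapped-false gapped _ d<s (inj₂ s<q+d)
    where
    d<s : q + (m + i) < s
    d<s = subst (q + (m + i) <_) s≡ (+-monoʳ-< q (+-monoʳ-< m i<q′))
    s<q+d : s < q + (q + (m + i))
    s<q+d = subst (s <_) (sym (trans (lengths₃ q′ o i) (cong (λ t → suc (i + t)) (m+[n∸m]≡n 2q≤s)))) (s≤s (m≤n+m s i))
  count≡middle : count g s ≡ count (λ i → g (q + i)) m
  count≡middle = trans (cong (count g) (sym s≡)) (count-trim g q m q′ prefix-false suffix-false)

_!_ : ∀ {n} → Vec Bool n → ℕ → Bool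
[]       ! _     = false
(x ∷ xs) ! zero  = x
(x ∷ xs) ! suc k = xs ! k

∣xs∣≡count[xs!] : ∀ {n} (xs : Subset n) → ∣ xs ∣ ≡ count (xs !_) n
∣xs∣≡count[xs!] []           = refl
∣xs∣≡count[xs!] (true ∷ xs)  = cong suc (∣xs∣≡count[xs!] xs)
∣xs∣≡count[xs!] (false ∷ xs) = ∣xs∣≡count[xs!] xs

!-true : ∀ {n} (xs : Subset n) k → xs ! k ≡ true → Σ (Fin n) λ v → toℕ v ≡ k × v ∈ xs
!-true (true ∷ xs) zero    _ = fzero , refl , here
!-true (x ∷ xs)    (suc k) e with !-true xs k e
... | v , v≡k , v∈xs = fsuc v , cong suc v≡k , there v∈xs

count[xs!%] : ∀ {n} .{{_ : NonZero n}} (xs : Subset n) c → count (λ i → xs ! ((c + i) % n)) n ≡ ∣ xs ∣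
count[xs!%] {n} xs c = begin
    count (λ i → xs ! ((c + i) % n)) n  ≡⟨ count-rotate (λ k → xs ! (k % n)) n c (λ i → cong (xs !_) ([m+n]%n≡m%n i n)) ⟩
    count (λ k → xs ! (k % n)) n        ≡⟨ count-cong n (λ k k<n → cong (xs !_) (m<n⇒m%n≡m k<n)) ⟩
    count (xs !_) n                     ≡⟨ ∣xs∣≡count[xs!] xs ⟨
    ∣ xs ∣                              ∎
  where open ≡-Reasoning

[1+m]%n : ∀ {n} .{{_ : NonZero n}} m → suc m % n ≡ suc (m % n) ⊎ (suc (m % n) ≡ n × suc m % n ≡ 0)
[1+m]%n {n} m with suc m % n in eq
... | zero  = inj₂ (trans (cong suc (%-pred-≡0 eq)) (suc-pred n) , refl)
... | suc j = inj₁ (cong suc (≤-antisym j≤m%n m%n≤j))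
  where
  j≤m%n : j ≤ m % n
  j≤m%n = m<[1+n%d]⇒m≤[n%d] m n (≤-reflexive (sym eq))
  m%n≤j : m % n ≤ j
  m%n≤j = [1+m%d]≤1+n⇒[m%d]≤n m j n (subst (0 <_) (sym eq) z<s) (≤-reflexive eq)

nextOf-% : ∀ {n} .{{_ : NonZero n}} {v w : Fin n} k → toℕ v ≡ k % n → toℕ w ≡ suc k % n → NextOf v w
nextOf-% k v≡ w≡ rewrite v≡ | w≡ = [1+m]%n k

independent⇒noConsecutive : ∀ {n} .{{_ : NonZero n}} {A : Subset n} → IndependentC A →
  NoConsecutive (λ k → A ! (k % n))
independent⇒noConsecutive {n} {A} indA k Ak with A ! (suc k % n) in Ak+1
... | false = refl
... | true  with !-true A (k % n) Ak | !-true A (suc k % n) Ak+1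
... | v , v≡ , v∈A | w , w≡ , w∈A = ⊥-elim (indA v w v∈A w∈A (inj₁ (nextOf-% k v≡ w≡)))

∣[b+d]%n-b∣ : ∀ {n} .{{_ : NonZero n}} b d → b < n → d ≤ n →
  ∣ (b + d) % n - b ∣ ≡ d ⊎ ∣ (b + d) % n - b ∣ ≡ n ∸ d
∣[b+d]%n-b∣ {n} b d b<n d≤n with <-≤-connex (b + d) n
... | inj₁ b+d<n = inj₁ (begin
    ∣ (b + d) % n - b ∣  ≡⟨ cong ∣_- b ∣ (m<n⇒m%n≡m b+d<n) ⟩
    ∣ b + d - b ∣        ≡⟨ ∣-∣-comm (b + d) b ⟩
    ∣ b - b + d ∣        ≡⟨ ∣m-m+n∣≡n b d ⟩
    d                    ∎)
  where open ≡-Reasoning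
... | inj₂ n≤b+d = inj₂ (begin
    ∣ (b + d) % n - b ∣              ≡⟨ cong ∣_- b ∣ [b+d]%n≡y ⟩
    ∣ y - b ∣                        ≡⟨ cong ∣ y -_∣ b≡y+[n∸d] ⟩
    ∣ y - y + (n ∸ d) ∣              ≡⟨ ∣m-m+n∣≡n y (n ∸ d) ⟩
    n ∸ d                            ∎)
  where
  open ≡-Reasoning
  y = b + d ∸ n
  n+y≡b+d : n + y ≡ b + d
  n+y≡b+d = m+[n∸m]≡n n≤b+d
  b≡y+[n∸d] : b ≡ y + (n ∸ d)
  b≡y+[n∸d] = +-cancelʳ-≡ d b (y + (n ∸ d)) (begin
    b + d                ≡⟨ n+y≡b+d ⟨
    n + y                ≡⟨ +-comm n y ⟩
    y + n                ≡⟨ cong (y +_) (m∸n+n≡m d≤n) ⟨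
    y + (n ∸ d + d)      ≡⟨ +-assoc y (n ∸ d) d ⟨
    y + (n ∸ d) + d      ∎)
  [b+d]%n≡y : (b + d) % n ≡ y
  [b+d]%n≡y = begin
    (b + d) % n  ≡⟨ cong (_% n) (trans (sym n+y≡b+d) (+-comm n y)) ⟩
    (y + n) % n  ≡⟨ [m+n]%n≡m%n y n ⟩
    y % n        ≡⟨ m<n⇒m%n≡m (≤-<-trans (subst (y ≤_) (sym b≡y+[n∸d]) (m≤m+n y _)) b<n) ⟩
    y            ∎

cdist-offset : ∀ {n} .{{_ : NonZero n}} (v b : Fin n) d → d ≤ n → toℕ v ≡ (toℕ b + d) % n →
  cdist v b ≡ d ⊓ (n ∸ d)
cdist-offset {n} v b d d≤n v≡ rewrite v≡ with ∣[b+d]%n-b∣ (toℕ b) d (toℕ<n b) d≤n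
... | inj₁ e rewrite e = refl
... | inj₂ e rewrite e = trans (cong ((n ∸ d) ⊓_) (m∸[m∸n]≡n d≤n)) (⊓-comm (n ∸ d) d)

cdist+cdist≤n : ∀ {n} (i j : Fin n) → cdist i j + cdist i j ≤ n
cdist+cdist≤n {n} i j = begin
    x ⊓ (n ∸ x) + x ⊓ (n ∸ x)  ≤⟨ +-mono-≤ (m⊓n≤m x _) (m⊓n≤n x _) ⟩
    x + (n ∸ x)                ≡⟨ m+[n∸m]≡n x≤n ⟩
    n                          ∎
  where
  open ≤-Reasoning
  x = ∣ toℕ i - toℕ j ∣
  x≤n : x ≤ n
  x≤n = ≤-trans (∣m-n∣≤m⊔n (toℕ i) (toℕ j)) (⊔-lub (<⇒≤ (toℕ<n i)) (<⇒≤ (toℕ<n j)))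

lemma3p7 : (s q : ℕ) → 3 ≤ s → 2 ≤ q → (A B : Subset s) →
    Nonempty A → Nonempty B → IndependentC A → IndependentC B →
    (∀ i j → i ∈ A → j ∈ (B ─ A) → q ≤ cdist i j) →
    Nonempty (B ─ A) →
    2 * ∣ A ∣ + 2 * q ≤ s + 2
lemma3p7 s q _ _ A B (a , a∈A) _ indA _ far (b , b∈B─A) = begin
    2 * ∣ A ∣ + 2 * q      ≡⟨ cong (λ k → 2 * k + 2 * q) (count[xs!%] A (toℕ b)) ⟨
    2 * count g s + 2 * q  ≤⟨ count-gapped g s q (noConsecutive-shift (toℕ b) (independent⇒noConsecutive indA)) 2q≤s gapped ⟩
    s + 2                  ∎
  where
  open ≤-Reasoning
  instance
    s≢0 : NonZero s
    s≢0 = nonZeroIndex b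
  g : ℕ → Bool
  g d = A ! ((toℕ b + d) % s)
  2q≤s : q + q ≤ s
  2q≤s = ≤-trans (+-mono-≤ (far a b a∈A b∈B─A) (far a b a∈A b∈B─A)) (cdist+cdist≤n a b)
  gapped : Gapped s q g
  gapped d d<s gd with !-true A _ gd
  ... | v , v≡ , v∈A = subst (q ≤_) (cdist-offset v b d (<⇒≤ d<s) v≡) (far v b v∈A b∈B─A)
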